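{- Let $\mathrm{le}=(\mathrm{le}(n))_{n\ge0}$ be Leech's word over $\{0,1,2\}$, the fixed point starting with $0$ of the morphism $0\mapsto 0121021201210$, $1\mapsto 1202102012021$, $2\mapsto 2010210122010\!\!$ — precisely, $2 \mapsto 2,0,1,0,2,1,0,1,2,0,1,0,2$. Then the running sum $\mathrm{sum}_{\mathrm{le}}(n)=\sum_{i=0}^{n}\mathrm{le}(i)$ (summing the values $0,1,2$ as integers) is not $13$-synchronised.
   Context: Explicitly the morphism is $0\mapsto 0,1,2,1,0,2,1,2,0,1,2,1,0$; $1\mapsto 1,2,0,2,1,0,2,0,1,2,0,2,1$; $2\mapsto 2,0,1,0,2,1,0,1,2,0,1,0,2$. A function $f:\mathbb{N}\to\mathbb{N}$ is $13$-synchronised if there is a finite automaton which, reading the base-$13$ representations of $n$ and $m$ in parallel (most significant digit first, the shorter padded with leading zeros), accepts exactly the pairs $(n,m)$ with $m = f(n)$. -}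

module Defs where

open import Data.Nat using (ℕ; zero; suc; _+_; _⊔_; _/_)
open import Data.Nat.DivMod using (_mod_)
open import Data.Fin using (Fin; zero; suc; toℕ)
open import Data.Vec using (Vec; []; _∷_; lookup)
open import Data.List using (List; []; _∷_; length; reverse; replicate; _++_; zip; foldl)
open import Data.Bool using (Bool)
open import Data.Product using (_×_; Σ)
open import Relation.Binary.PropositionalEquality using (_≡_)
open import Function.Bundles using (_⇔_)

l0 l1 l2 : Fin 3
l0 = zero
l1 = suc zero
l2 = suc (suc zero)

leechMorphism : Fin 3 → Vec (Fin 3) 13
leechMorphism zero =
  l0 ∷ l1 ∷ l2 ∷ l1 ∷ l0 ∷ l2 ∷ l1 ∷ l2 ∷ l0 ∷ l1 ∷ l2 ∷ l1 ∷ l0 ∷ []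
leechMorphism (suc zero) =
  l1 ∷ l2 ∷ l0 ∷ l2 ∷ l1 ∷ l0 ∷ l2 ∷ l0 ∷ l1 ∷ l2 ∷ l0 ∷ l2 ∷ l1 ∷ []
leechMorphism (suc (suc zero)) =
  l2 ∷ l0 ∷ l1 ∷ l0 ∷ l2 ∷ l1 ∷ l0 ∷ l1 ∷ l2 ∷ l0 ∷ l1 ∷ l0 ∷ l2 ∷ []

-- The fixed point starting with 0 of a 13-uniform morphism h satisfies
-- le(0) = 0 and le(13q + r) = h(le q)[r].  We compute it with fuel:
-- the first argument is fuel (fuel n for argument n always suffices).
leechAux : ℕ → ℕ → Fin 3
leechAux zero    n = l0
leechAux (suc k) n = lookup (leechMorphism (leechAux k (n / 13))) (n mod 13)

le : ℕ → Fin 3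
le n = leechAux n n

sumLe : ℕ → ℕ
sumLe zero    = toℕ (le zero)
sumLe (suc n) = sumLe n + toℕ (le (suc n))

-- Base-13 digits, least significant first, no leading zeros (0 ↦ empty word);
-- first argument is fuel.
digitsAux : ℕ → ℕ → List (Fin 13)
digitsAux zero    _       = []
digitsAux (suc k) zero    = []
digitsAux (suc k) (suc n) = (suc n mod 13) ∷ digitsAux k (suc n / 13)

digitsLSB : ℕ → List (Fin 13)
digitsLSB n = digitsAux n n

padTo : ℕ → List (Fin 13) → List (Fin 13)
padTo L ds = ds ++ replicate (L Data.Nat.∸ length ds) zero

-- Parallel base-13 encoding of (n, m), most significant digit first,
-- the shorter representation padded with leading zeros.
encodePair : ℕ → ℕ → List (Fin 13 × Fin 13)
encodePair n m =
  let dn = digitsLSB n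
      dm = digitsLSB m
      L  = length dn ⊔ length dm
  in reverse (zip (padTo L dn) (padTo L dm))

record DFA (k : ℕ) (Σ' : Set) : Set where
  field
    start  : Fin k
    δ      : Fin k → Σ' → Fin k
    accept : Fin k → Bool

run : ∀ {k Σ'} → DFA k Σ' → List Σ' → Bool
run A w = DFA.accept A (foldl (DFA.δ A) (DFA.start A) w)

Synchronised13 : (ℕ → ℕ) → Set
Synchronised13 f =
  Σ ℕ λ k → Σ (DFA k (Fin 13 × Fin 13)) λ A →
    ∀ n m → (run A (encodePair n m) ≡ Bool.true) ⇔ (m ≡ f n)

{-# OPTIONS --safe #-}
module Submission where

-- Let R j be the base-13 repunit with j digits, so R (j + 1) = 13 R j + 1.  The prefix of length
-- 13n + 1 of Leech's word is the image of the prefix of length n followed by le(n); on Parikh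
-- vectors this is the circulant incidence matrix plus a unit vector.  Hence the Parikh vector of
-- the prefix of length R j has two equal coordinates and a third one exceeding them by j, and for
-- j = 3L this gives sum_le(R (3L)) = R (3L) + 3L.
-- Given an automaton with k states, let a = k + 1 and n_b = R (3a + 3b) for 1 ≤ b ≤ a.  The input
-- for (n_b, sum_le(n_b)) is the top 3b digits of n_b on both tracks followed by a block of 3a
-- digits carrying R (3a) and R (3a) + 3(a + b).  Two of the a prefixes lead to the same state, so
-- the automaton also accepts some (n_b, m) with m ≠ sum_le(n_b).

open import Defs
open import Relation.Nullary using (¬_)
open import Data.Empty using (⊥)
open import Data.Nat using (ℕ; zero; suc; _+_; _*_; _^_; _≤_; _<_; z≤n; s≤s; _/_; _⊔_; NonZero)
open import Data.Nat.Properties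
open import Data.Nat.DivMod
open import Data.Nat.Divisibility using (divides-refl)
open import Data.Nat.Tactic.RingSolver using (solve-∀)
open import Data.Fin using (Fin; zero; suc; toℕ)
open import Data.Fin.Properties using (fromℕ<-cong; toℕ-injective; toℕ<n; pigeonhole)
open import Data.Vec using (lookup)
open import Data.List using (List; []; _∷_; length; reverse; replicate; _++_; zip; foldl)
open import Data.List.Properties using (++-identityʳ; length-++; reverse-++; foldl-++)
open import Data.Bool using (true)
open import Data.Product using (_×_; _,_; Σ)
open import Relation.Binary.PropositionalEquality
open import Function.Bundles using (Equivalence)

[m+kn]/n≡m/n+k : ∀ m k n .{{_ : NonZero n}} → (m + k * n) / n ≡ m / n + k
[m+kn]/n≡m/n+k m k n = trans (+-distrib-/-∣ʳ m (divides-refl k)) (cong (m / n +_) (m*n/n≡m k n))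

[m+kn]mod-n≡m-mod-n : ∀ m k n .{{_ : NonZero n}} → (m + k * n) mod n ≡ m mod n
[m+kn]mod-n≡m-mod-n m k n = fromℕ<-cong _ _ ([m+kn]%n≡m%n m k n) _ _

n≤1+k⇒n/13≤k : ∀ {n k} → n ≤ suc k → n / 13 ≤ k
n≤1+k⇒n/13≤k {zero}  _         = z≤n
n≤1+k⇒n/13≤k {suc n} (s≤s n≤k) = ≤-trans (≤-pred (m/n<m (suc n) 13 (s≤s (s≤s z≤n)))) n≤k

-- Leech's word as a fixed point

leechAux-0 : ∀ k → leechAux k 0 ≡ l0
leechAux-0 zero    = refl
leechAux-0 (suc k) = cong (λ a → lookup (leechMorphism a) (0 mod 13)) (leechAux-0 k)

leechAux-fuel : ∀ {k k′ n} → n ≤ k → n ≤ k′ → leechAux k n ≡ leechAux k′ n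
leechAux-fuel {zero}  {k′}     z≤n _   = sym (leechAux-0 k′)
leechAux-fuel {suc k} {zero}   _   z≤n = leechAux-0 (suc k)
leechAux-fuel {suc k} {suc k′} {n} p p′ =
  cong (λ a → lookup (leechMorphism a) (n mod 13)) (leechAux-fuel (n≤1+k⇒n/13≤k p) (n≤1+k⇒n/13≤k p′))

le-unfold : ∀ n → le n ≡ lookup (leechMorphism (le (n / 13))) (n mod 13)
le-unfold zero    = refl
le-unfold (suc n) = cong (λ a → lookup (leechMorphism a) (suc n mod 13))
  (leechAux-fuel {n} (n≤1+k⇒n/13≤k ≤-refl) ≤-refl)

le-r+q*13 : ∀ q r → r < 13 → le (r + q * 13) ≡ lookup (leechMorphism (le q)) (r mod 13)
le-r+q*13 q r r<13 = trans (le-unfold (r + q * 13)) (cong₂ (λ m i → lookup (leechMorphism (le m)) i)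
  (trans ([m+kn]/n≡m/n+k r q 13) (cong (_+ q) (m<n⇒m/n≡0 r<13)))
  ([m+kn]mod-n≡m-mod-n r q 13))

next : Fin 3 → Fin 3
next zero             = l1
next (suc zero)       = l2
next (suc (suc zero)) = l0

lookup-leechMorphism-1 : ∀ a → lookup (leechMorphism a) (1 mod 13) ≡ next a
lookup-leechMorphism-1 zero             = refl
lookup-leechMorphism-1 (suc zero)       = refl
lookup-leechMorphism-1 (suc (suc zero)) = refl

le-1+q*13 : ∀ q → le (1 + q * 13) ≡ next (le q)
le-1+q*13 q = trans (le-r+q*13 q 1 (s≤s (s≤s z≤n))) (lookup-leechMorphism-1 (le q))

-- Parikh vectors of prefixes

record Parikh : Set where
  constructor ⟨_,_,_⟩
  field
    n₀ n₁ n₂ : ℕ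
open Parikh

⟨⟩-cong : ∀ {a b c a′ b′ c′} → a ≡ a′ → b ≡ b′ → c ≡ c′ → ⟨ a , b , c ⟩ ≡ ⟨ a′ , b′ , c′ ⟩
⟨⟩-cong refl refl refl = refl

𝟘 : Parikh
𝟘 = ⟨ 0 , 0 , 0 ⟩

infixl 6 _⊕_
_⊕_ : Parikh → Parikh → Parikh
⟨ a , b , c ⟩ ⊕ ⟨ a′ , b′ , c′ ⟩ = ⟨ a + a′ , b + b′ , c + c′ ⟩

⊕-assoc : ∀ u v w → (u ⊕ v) ⊕ w ≡ u ⊕ (v ⊕ w)
⊕-assoc u v w = ⟨⟩-cong (+-assoc (n₀ u) _ _) (+-assoc (n₁ u) _ _) (+-assoc (n₂ u) _ _)

⊕-identityʳ : ∀ u → u ⊕ 𝟘 ≡ u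
⊕-identityʳ u = ⟨⟩-cong (+-identityʳ (n₀ u)) (+-identityʳ (n₁ u)) (+-identityʳ (n₂ u))

unit : Fin 3 → Parikh
unit zero             = ⟨ 1 , 0 , 0 ⟩
unit (suc zero)       = ⟨ 0 , 1 , 0 ⟩
unit (suc (suc zero)) = ⟨ 0 , 0 , 1 ⟩

rotate : Parikh → Parikh
rotate ⟨ a , b , c ⟩ = ⟨ c , a , b ⟩

unit-next : ∀ a → unit (next a) ≡ rotate (unit a)
unit-next zero             = refl
unit-next (suc zero)       = refl
unit-next (suc (suc zero)) = refl

-- Column a counts the letters of leechMorphism a (blockParikh-13); the matrix is circulant.
incidence : Parikh → Parikh
incidence ⟨ x , y , z ⟩ = ⟨ 4 * x + 4 * y + 5 * z , 5 * x + 4 * y + 4 * z , 4 * x + 5 * y + 4 * z ⟩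

incidence-⊕ : ∀ u v → incidence (u ⊕ v) ≡ incidence u ⊕ incidence v
incidence-⊕ ⟨ x , y , z ⟩ ⟨ x′ , y′ , z′ ⟩ = ⟨⟩-cong
  (linear 4 4 5 x y z x′ y′ z′) (linear 5 4 4 x y z x′ y′ z′) (linear 4 5 4 x y z x′ y′ z′)
  where
  linear : ∀ p q r x y z x′ y′ z′ → p * (x + x′) + q * (y + y′) + r * (z + z′)
                                  ≡ p * x + q * y + r * z + (p * x′ + q * y′ + r * z′)
  linear = solve-∀

incidence-rotate : ∀ v → incidence (rotate v) ≡ rotate (incidence v)
incidence-rotate ⟨ x , y , z ⟩ =
  ⟨⟩-cong (cycle (4 * z) (4 * x) (5 * y)) (cycle (5 * z) (4 * x) (4 * y)) (cycle (4 * z) (5 * x) (4 * y))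
  where
  cycle : ∀ a b c → a + b + c ≡ b + c + a
  cycle a b c = trans (+-assoc a b c) (+-comm a (b + c))

incidence-⊕-unit-rotate : ∀ a v {w} → incidence v ⊕ unit a ≡ w →
                          incidence (rotate v) ⊕ unit (next a) ≡ rotate w
incidence-⊕-unit-rotate a v eq = trans (cong₂ _⊕_ (incidence-rotate v) (unit-next a)) (cong rotate eq)

parikh : ℕ → Parikh
parikh zero    = 𝟘
parikh (suc n) = parikh n ⊕ unit (le n)

blockParikh : Fin 3 → ℕ → Parikh
blockParikh a zero    = 𝟘
blockParikh a (suc r) = blockParikh a r ⊕ unit (lookup (leechMorphism a) (r mod 13))

blockParikh-1 : ∀ a → blockParikh a 1 ≡ unit a
blockParikh-1 zero             = refl
blockParikh-1 (suc zero)       = refl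
blockParikh-1 (suc (suc zero)) = refl

blockParikh-13 : ∀ a → blockParikh a 13 ≡ incidence (unit a)
blockParikh-13 zero             = refl
blockParikh-13 (suc zero)       = refl
blockParikh-13 (suc (suc zero)) = refl

parikh-within-block : ∀ q r → r ≤ 13 → parikh (r + q * 13) ≡ parikh (q * 13) ⊕ blockParikh (le q) r
parikh-within-block q zero    _       = sym (⊕-identityʳ (parikh (q * 13)))
parikh-within-block q (suc r) 1+r≤13 = begin
  parikh (r + q * 13) ⊕ unit (le (r + q * 13))
    ≡⟨ cong₂ _⊕_ (parikh-within-block q r (<⇒≤ 1+r≤13)) (cong unit (le-r+q*13 q r 1+r≤13)) ⟩
  parikh (q * 13) ⊕ blockParikh (le q) r ⊕ unit (lookup (leechMorphism (le q)) (r mod 13))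
    ≡⟨ ⊕-assoc (parikh (q * 13)) _ _ ⟩
  parikh (q * 13) ⊕ blockParikh (le q) (suc r) ∎
  where open ≡-Reasoning

parikh-q*13 : ∀ q → parikh (q * 13) ≡ incidence (parikh q)
parikh-q*13 zero    = refl
parikh-q*13 (suc q) = begin
  parikh (13 + q * 13)                             ≡⟨ parikh-within-block q 13 ≤-refl ⟩
  parikh (q * 13) ⊕ blockParikh (le q) 13          ≡⟨ cong₂ _⊕_ (parikh-q*13 q) (blockParikh-13 (le q)) ⟩
  incidence (parikh q) ⊕ incidence (unit (le q))   ≡⟨ incidence-⊕ (parikh q) (unit (le q)) ⟨
  incidence (parikh (suc q))                       ∎
  where open ≡-Reasoning

parikh-1+q*13 : ∀ q → parikh (1 + q * 13) ≡ incidence (parikh q) ⊕ unit (le q)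
parikh-1+q*13 q = trans (parikh-within-block q 1 (s≤s z≤n))
  (cong₂ _⊕_ (parikh-q*13 q) (blockParikh-1 (le q)))

weight : Parikh → ℕ
weight v = n₁ v + 2 * n₂ v

size : Parikh → ℕ
size v = n₀ v + n₁ v + n₂ v

weight-⊕ : ∀ u v → weight (u ⊕ v) ≡ weight u + weight v
weight-⊕ u v = lemma (n₁ u) (n₂ u) (n₁ v) (n₂ v)
  where
  lemma : ∀ y z y′ z′ → y + y′ + 2 * (z + z′) ≡ y + 2 * z + (y′ + 2 * z′)
  lemma = solve-∀

size-⊕ : ∀ u v → size (u ⊕ v) ≡ size u + size v
size-⊕ u v = lemma (n₀ u) (n₁ u) (n₂ u) (n₀ v) (n₁ v) (n₂ v)
  where
  lemma : ∀ x y z x′ y′ z′ → x + x′ + (y + y′) + (z + z′) ≡ x + y + z + (x′ + y′ + z′)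
  lemma = solve-∀

weight-unit : ∀ a → weight (unit a) ≡ toℕ a
weight-unit zero             = refl
weight-unit (suc zero)       = refl
weight-unit (suc (suc zero)) = refl

size-unit : ∀ a → size (unit a) ≡ 1
size-unit zero             = refl
size-unit (suc zero)       = refl
size-unit (suc (suc zero)) = refl

sumLe-weight : ∀ n → sumLe n ≡ weight (parikh (suc n))
sumLe-weight zero    = refl
sumLe-weight (suc n) = begin
  sumLe n + toℕ (le (suc n))
    ≡⟨ cong₂ _+_ (sumLe-weight n) (sym (weight-unit (le (suc n)))) ⟩
  weight (parikh (suc n)) + weight (unit (le (suc n)))
    ≡⟨ weight-⊕ (parikh (suc n)) (unit (le (suc n))) ⟨
  weight (parikh (suc (suc n)))
    ∎
  where open ≡-Reasoning

size-parikh : ∀ n → size (parikh n) ≡ n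
size-parikh zero    = refl
size-parikh (suc n) = begin
  size (parikh n ⊕ unit (le n))        ≡⟨ size-⊕ (parikh n) (unit (le n)) ⟩
  size (parikh n) + size (unit (le n)) ≡⟨ cong₂ _+_ (size-parikh n) (size-unit (le n)) ⟩
  n + 1                                ≡⟨ +-comm n 1 ⟩
  suc n                                ∎
  where open ≡-Reasoning

-- Repunits

repunit : ℕ → ℕ
repunit zero    = 0
repunit (suc j) = 1 + repunit j * 13

le-repunit-3L : ∀ L → le (repunit (3 * L)) ≡ l0
le-repunit-3L zero    = refl
le-repunit-3L (suc L) = begin
  le (repunit (3 * suc L))                      ≡⟨ cong (λ j → le (repunit j)) (*-suc 3 L) ⟩
  le (repunit (suc (suc (suc j))))              ≡⟨ le-1+q*13 (repunit (suc (suc j))) ⟩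
  next (le (repunit (suc (suc j))))             ≡⟨ cong next (le-1+q*13 (repunit (suc j))) ⟩
  next (next (le (repunit (suc j))))            ≡⟨ cong (λ a → next (next a)) (le-1+q*13 (repunit j)) ⟩
  next (next (next (le (repunit j))))           ≡⟨ cong (λ a → next (next (next a))) (le-repunit-3L L) ⟩
  l0                                            ∎
  where
  open ≡-Reasoning
  j : ℕ
  j = 3 * L

shaped : Fin 3 → ℕ → ℕ → Parikh
shaped zero             u w = ⟨ u , u , w ⟩
shaped (suc zero)       u w = ⟨ w , u , u ⟩
shaped (suc (suc zero)) u w = ⟨ u , w , u ⟩

incidence-shaped-l0 : ∀ u d → incidence (shaped l0 u (u + d)) ⊕ unit l0
                             ≡ shaped l1 (13 * u + 4 * d) (13 * u + 4 * d + suc d)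
incidence-shaped-l0 u d = ⟨⟩-cong (e₀ u d) (e₁ u d) (e₂ u d)
  where
  e₀ : ∀ u d → 4 * u + 4 * u + 5 * (u + d) + 1 ≡ 13 * u + 4 * d + suc d
  e₀ = solve-∀
  e₁ : ∀ u d → 5 * u + 4 * u + 4 * (u + d) + 0 ≡ 13 * u + 4 * d
  e₁ = solve-∀
  e₂ : ∀ u d → 4 * u + 5 * u + 4 * (u + d) + 0 ≡ 13 * u + 4 * d
  e₂ = solve-∀

incidence-shaped : ∀ a u d → incidence (shaped a u (u + d)) ⊕ unit a
                           ≡ shaped (next a) (13 * u + 4 * d) (13 * u + 4 * d + suc d)
incidence-shaped zero             u d = incidence-shaped-l0 u d
incidence-shaped (suc zero)       u d =
  incidence-⊕-unit-rotate l0 (shaped l0 u (u + d)) (incidence-shaped-l0 u d)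
incidence-shaped (suc (suc zero)) u d =
  incidence-⊕-unit-rotate l1 (shaped l1 u (u + d)) (incidence-shaped (suc zero) u d)

parikh-repunit : ∀ j → Σ ℕ λ u → parikh (repunit j) ≡ shaped (le (repunit j)) u (u + j)
parikh-repunit zero = 0 , refl
parikh-repunit (suc j) with parikh-repunit j
... | u , eq = 13 * u + 4 * j , (begin
  parikh (1 + R * 13)                                 ≡⟨ parikh-1+q*13 R ⟩
  incidence (parikh R) ⊕ unit (le R)                  ≡⟨ cong (λ v → incidence v ⊕ unit (le R)) eq ⟩
  incidence (shaped (le R) u (u + j)) ⊕ unit (le R)   ≡⟨ incidence-shaped (le R) u j ⟩
  shaped (next (le R)) u′ (u′ + suc j)                ≡⟨ cong (λ a → shaped a u′ (u′ + suc j)) (le-1+q*13 R) ⟨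
  shaped (le (1 + R * 13)) u′ (u′ + suc j)            ∎)
  where
  open ≡-Reasoning
  R u′ : ℕ
  R = repunit j
  u′ = 13 * u + 4 * j

sumLe-repunit-3L : ∀ L → sumLe (repunit (3 * L)) ≡ repunit (3 * L) + 3 * L
sumLe-repunit-3L L with parikh-repunit (3 * L)
... | u , eq = begin
  sumLe R                                           ≡⟨ sumLe-weight R ⟩
  weight (parikh R ⊕ unit (le R))                   ≡⟨ cong₂ (λ v a → weight (v ⊕ unit a)) balanced le-R ⟩
  weight (⟨ u , u , u + 3 * L ⟩ ⊕ unit l0)          ≡⟨ count u (3 * L) ⟩
  size ⟨ u , u , u + 3 * L ⟩ + 3 * L                ≡⟨ cong (λ v → size v + 3 * L) balanced ⟨
  size (parikh R) + 3 * L                           ≡⟨ cong (_+ 3 * L) (size-parikh R) ⟩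
  R + 3 * L                                         ∎
  where
  open ≡-Reasoning
  R : ℕ
  R = repunit (3 * L)
  le-R : le R ≡ l0
  le-R = le-repunit-3L L
  balanced : parikh R ≡ ⟨ u , u , u + 3 * L ⟩
  balanced = trans eq (cong (λ a → shaped a u (u + 3 * L)) le-R)
  count : ∀ u d → u + 0 + 2 * (u + d + 0) ≡ u + u + (u + d) + d
  count = solve-∀

repunit-+ : ∀ i j → repunit (i + j) ≡ 13 ^ i * repunit j + repunit i
repunit-+ zero    j = sym (trans (+-identityʳ (1 * repunit j)) (*-identityˡ (repunit j)))
repunit-+ (suc i) j =
  trans (cong (λ r → 1 + r * 13) (repunit-+ i j)) (lemma (13 ^ i) (repunit j) (repunit i))
  where
  lemma : ∀ p r s → 1 + (p * r + s) * 13 ≡ 13 * p * r + (1 + s * 13)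
  lemma = solve-∀

repunit+2j<13^j : ∀ j → repunit j + 2 * j < 13 ^ j
repunit+2j<13^j zero    = s≤s z≤n
repunit+2j<13^j (suc j) = begin
  suc (repunit (suc j) + 2 * suc j)      ≤⟨ m≤m+n _ (9 + 24 * j) ⟩
  suc (repunit (suc j) + 2 * suc j) + (9 + 24 * j)
                                         ≡⟨ lemma (repunit j) j ⟩
  13 * suc (repunit j + 2 * j)           ≤⟨ *-monoʳ-≤ 13 (repunit+2j<13^j j) ⟩
  13 * 13 ^ j                            ∎
  where
  open ≤-Reasoning
  lemma : ∀ r j → 1 + (1 + r * 13 + 2 * (1 + j)) + (9 + 24 * j) ≡ 13 * (1 + (r + 2 * j))
  lemma = solve-∀

-- Base-13 digits

digitsAux-0 : ∀ k → digitsAux k 0 ≡ []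
digitsAux-0 zero    = refl
digitsAux-0 (suc k) = refl

digitsAux-fuel : ∀ {k k′ n} → n ≤ k → n ≤ k′ → digitsAux k n ≡ digitsAux k′ n
digitsAux-fuel {zero}  {k′}              z≤n _   = sym (digitsAux-0 k′)
digitsAux-fuel {suc k} {zero}            _   z≤n = refl
digitsAux-fuel {suc k} {suc k′} {zero}   _   _   = refl
digitsAux-fuel {suc k} {suc k′} {suc n}  p   p′  =
  cong (suc n mod 13 ∷_) (digitsAux-fuel (n≤1+k⇒n/13≤k p) (n≤1+k⇒n/13≤k p′))

digitsLSB-step : ∀ n → 0 < n → digitsLSB n ≡ n mod 13 ∷ digitsLSB (n / 13)
digitsLSB-step (suc n) _ = cong (suc n mod 13 ∷_) (digitsAux-fuel {n} (n≤1+k⇒n/13≤k ≤-refl) ≤-refl)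

lowDigits : ℕ → ℕ → List (Fin 13)
lowDigits zero    _ = []
lowDigits (suc s) B = B mod 13 ∷ lowDigits s (B / 13)

length-lowDigits : ∀ s B → length (lowDigits s B) ≡ s
length-lowDigits zero    _ = refl
length-lowDigits (suc s) B = cong suc (length-lowDigits s (B / 13))

digitsLSB-split : ∀ s {A B} → 0 < A → B < 13 ^ s →
                  digitsLSB (13 ^ s * A + B) ≡ lowDigits s B ++ digitsLSB A
digitsLSB-split zero {A} {zero} _ _ = cong digitsLSB (trans (+-identityʳ (1 * A)) (*-identityˡ A))
digitsLSB-split zero {B = suc _} _ (s≤s ())
digitsLSB-split (suc s) {A} {B} A>0 B<13^[1+s] = begin
  digitsLSB (13 ^ suc s * A + B)
    ≡⟨ cong digitsLSB (lemma (13 ^ s) A B) ⟩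
  digitsLSB (B + K * 13)
    ≡⟨ digitsLSB-step (B + K * 13) N>0 ⟩
  (B + K * 13) mod 13 ∷ digitsLSB ((B + K * 13) / 13)
    ≡⟨ cong₂ _∷_ ([m+kn]mod-n≡m-mod-n B K 13) (cong digitsLSB B/13+K) ⟩
  B mod 13 ∷ digitsLSB (13 ^ s * A + B / 13)
    ≡⟨ cong (B mod 13 ∷_) (digitsLSB-split s A>0 B/13<13^s) ⟩
  B mod 13 ∷ lowDigits s (B / 13) ++ digitsLSB A
    ∎
  where
  open ≡-Reasoning
  K : ℕ
  K = 13 ^ s * A
  lemma : ∀ p a b → 13 * p * a + b ≡ b + p * a * 13
  lemma = solve-∀
  N>0 : 0 < B + K * 13
  N>0 = ≤-trans (*-mono-≤ (*-mono-≤ (m^n>0 13 s) A>0) (s≤s z≤n)) (m≤n+m (K * 13) B)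
  B/13+K : (B + K * 13) / 13 ≡ K + B / 13
  B/13+K = trans ([m+kn]/n≡m/n+k B K 13) (+-comm (B / 13) K)
  B/13<13^s : B / 13 < 13 ^ s
  B/13<13^s = m<n*o⇒m/o<n (subst (B <_) (*-comm 13 (13 ^ s)) B<13^[1+s])

padTo-length : ∀ xs → padTo (length xs) xs ≡ xs
padTo-length xs = trans (cong (λ t → xs ++ replicate t zero) (n∸n≡0 (length xs))) (++-identityʳ xs)

encodePair-equal-length : ∀ n m → length (digitsLSB n) ≡ length (digitsLSB m) →
                          encodePair n m ≡ reverse (zip (digitsLSB n) (digitsLSB m))
encodePair-equal-length n m eq = cong₂ (λ xs ys → reverse (zip xs ys))
  (trans (cong (λ L → padTo L (digitsLSB n)) (trans (cong (length (digitsLSB n) ⊔_) (sym eq)) (⊔-idem _)))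
         (padTo-length (digitsLSB n)))
  (trans (cong (λ L → padTo L (digitsLSB m)) (trans (cong (_⊔ length (digitsLSB m)) eq) (⊔-idem _)))
         (padTo-length (digitsLSB m)))

zip-++ : ∀ {A B : Set} (xs : List A) (xs′ : List B) ys ys′ → length xs ≡ length xs′ →
         zip (xs ++ ys) (xs′ ++ ys′) ≡ zip xs xs′ ++ zip ys ys′
zip-++ []       []        ys ys′ _  = refl
zip-++ (x ∷ xs) (x′ ∷ xs′) ys ys′ eq = cong ((x , x′) ∷_) (zip-++ xs xs′ ys ys′ (suc-injective eq))

encodePair-common-high : ∀ s {A B B′} → 0 < A → B < 13 ^ s → B′ < 13 ^ s →
  encodePair (13 ^ s * A + B) (13 ^ s * A + B′)
    ≡ reverse (zip (digitsLSB A) (digitsLSB A)) ++ reverse (zip (lowDigits s B) (lowDigits s B′))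
encodePair-common-high s {A} {B} {B′} A>0 B< B′< = begin
  encodePair (13 ^ s * A + B) (13 ^ s * A + B′)
    ≡⟨ encodePair-equal-length (13 ^ s * A + B) (13 ^ s * A + B′)
         (trans (length-digits B<) (sym (length-digits B′<))) ⟩
  reverse (zip (digitsLSB (13 ^ s * A + B)) (digitsLSB (13 ^ s * A + B′)))
    ≡⟨ cong₂ (λ xs ys → reverse (zip xs ys)) split split′ ⟩
  reverse (zip (lowDigits s B ++ dA) (lowDigits s B′ ++ dA))
    ≡⟨ cong reverse (zip-++ (lowDigits s B) (lowDigits s B′) dA dA
         (trans (length-lowDigits s B) (sym (length-lowDigits s B′)))) ⟩
  reverse (zip (lowDigits s B) (lowDigits s B′) ++ zip dA dA)
    ≡⟨ reverse-++ (zip (lowDigits s B) (lowDigits s B′)) (zip dA dA) ⟩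
  reverse (zip dA dA) ++ reverse (zip (lowDigits s B) (lowDigits s B′)) ∎
  where
  open ≡-Reasoning
  dA : List (Fin 13)
  dA = digitsLSB A
  split : digitsLSB (13 ^ s * A + B) ≡ lowDigits s B ++ dA
  split = digitsLSB-split s A>0 B<
  split′ : digitsLSB (13 ^ s * A + B′) ≡ lowDigits s B′ ++ dA
  split′ = digitsLSB-split s A>0 B′<
  length-digits : ∀ {C} → C < 13 ^ s → length (digitsLSB (13 ^ s * A + C)) ≡ s + length dA
  length-digits {C} C< = trans (cong length (digitsLSB-split s A>0 C<))
    (trans (length-++ (lowDigits s C)) (cong (_+ length dA) (length-lowDigits s C)))

-- Fooling sets

no-fooling-set : ∀ {k Σ′} (A : DFA k Σ′) (u v : Fin (suc k) → List Σ′) →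
                 (∀ i → run A (u i ++ v i) ≡ true) →
                 (∀ i j → run A (u j ++ v i) ≡ true → i ≡ j) → ⊥
no-fooling-set {k} A u v accepts separates =
  let i , j , i<j , same = pigeonhole (n<1+n k) state
  in <⇒≢ i<j (cong toℕ (separates i j (crossed i j (sym same))))
  where
  open DFA A
  state : Fin (suc k) → Fin k
  state i = foldl δ start (u i)
  crossed : ∀ i j → state j ≡ state i → run A (u j ++ v i) ≡ true
  crossed i j eq = begin
    run A (u j ++ v i)                 ≡⟨ cong accept (foldl-++ δ start (u j) (v i)) ⟩
    accept (foldl δ (state j) (v i))   ≡⟨ cong (λ q → accept (foldl δ q (v i))) eq ⟩
    accept (foldl δ (state i) (v i))   ≡⟨ cong accept (foldl-++ δ start (u i) (v i)) ⟨
    run A (u i ++ v i)                 ≡⟨ accepts i ⟩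
    true                               ∎
    where open ≡-Reasoning

module LeechFoolingSet (k : ℕ) where

  s : ℕ
  s = 3 * suc k

  high : Fin (suc k) → ℕ
  high j = 13 ^ s * repunit (3 * suc (toℕ j))

  low : Fin (suc k) → ℕ
  low i = repunit s + 3 * (suc k + suc (toℕ i))

  n : Fin (suc k) → ℕ
  n j = high j + repunit s

  prefix : Fin (suc k) → List (Fin 13 × Fin 13)
  prefix j = reverse (zip d d)
    where
    d : List (Fin 13)
    d = digitsLSB (repunit (3 * suc (toℕ j)))

  suffix : Fin (suc k) → List (Fin 13 × Fin 13)
  suffix i = reverse (zip (lowDigits s (repunit s)) (lowDigits s (low i)))

  low<13^s : ∀ i → low i < 13 ^ s
  low<13^s i = ≤-<-trans (+-monoʳ-≤ (repunit s) excess≤2s) (repunit+2j<13^j s)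
    where
    lemma : ∀ a → 3 * (a + a) ≡ 2 * (3 * a)
    lemma = solve-∀
    excess≤2s : 3 * (suc k + suc (toℕ i)) ≤ 2 * s
    excess≤2s = ≤-trans (*-monoʳ-≤ 3 (+-monoʳ-≤ (suc k) (toℕ<n i))) (≤-reflexive (lemma (suc k)))

  encodePair-n : ∀ i j → encodePair (n j) (high j + low i) ≡ prefix j ++ suffix i
  encodePair-n i j =
    encodePair-common-high s (s≤s z≤n) (≤-<-trans (m≤m+n (repunit s) _) (low<13^s i)) (low<13^s i)

  sumLe-n : ∀ j → sumLe (n j) ≡ high j + low j
  sumLe-n j = begin
    sumLe (n j)                      ≡⟨ cong sumLe digits ⟨
    sumLe (repunit (3 * L))          ≡⟨ sumLe-repunit-3L L ⟩
    repunit (3 * L) + 3 * L          ≡⟨ cong (_+ 3 * L) digits ⟩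
    n j + 3 * L                      ≡⟨ +-assoc (high j) (repunit s) (3 * L) ⟩
    high j + low j                   ∎
    where
    open ≡-Reasoning
    L : ℕ
    L = suc k + suc (toℕ j)
    digits : repunit (3 * L) ≡ n j
    digits = trans (cong repunit (*-distribˡ-+ 3 (suc k) (suc (toℕ j)))) (repunit-+ s _)

  low-injective : ∀ i j → low i ≡ low j → i ≡ j
  low-injective i j eq =
    toℕ-injective (suc-injective (+-cancelˡ-≡ (suc k) _ _
      (*-cancelˡ-≡ _ _ 3 (+-cancelˡ-≡ (repunit s) _ _ eq))))

mainTheorem7 : ¬ Synchronised13 sumLe
mainTheorem7 (k , A , synchronised) = no-fooling-set A prefix suffix accepts separates
  where
  open LeechFoolingSet k
  open Equivalence
  open ≡-Reasoning
  accepts : ∀ i → run A (prefix i ++ suffix i) ≡ true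
  accepts i = begin
    run A (prefix i ++ suffix i)                 ≡⟨ cong (run A) (encodePair-n i i) ⟨
    run A (encodePair (n i) (high i + low i))    ≡⟨ from (synchronised (n i) _) (sym (sumLe-n i)) ⟩
    true                                         ∎
  separates : ∀ i j → run A (prefix j ++ suffix i) ≡ true → i ≡ j
  separates i j accepted = low-injective i j (+-cancelˡ-≡ (high j) _ _ (begin
    high j + low i   ≡⟨ to (synchronised (n j) _) (trans (cong (run A) (encodePair-n i j)) accepted) ⟩
    sumLe (n j)      ≡⟨ sumLe-n j ⟩
    high j + low j   ∎))
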